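{- Let $\mathbb{F}$ be a field, $\mathcal{D}\leq M(n,\mathbb{F})$ a matrix space and $U,U'\leq\mathbb{F}^n$ subspaces. Let $\ell$ be the smallest integer $j\geq1$ with $\mathcal{D}^j(U)\not\subseteq U'$ if such an integer exists, and $\ell=n$ otherwise. For $i\in\{1,\dots,\ell\}$ let $$\mathcal{H}_i=\{X\in\mathcal{D}:\ \mathcal{D}^{\ell-j}X\mathcal{D}^{j-1}(U)\subseteq U'\ \text{for all } j\in\{1,\dots,\ell\}\setminus\{i\}\}.$$ Then for every matrix $X=X_1+\dots+X_\ell$ with $X_i\in\mathcal{H}_i$, we have $X^\ell(U)\subseteq U'$ if and only if $X_\ell\cdots X_2X_1(U)\subseteq U'$.
   Context: $\mathcal{D}^k$ denotes the linear span of all products of $k$ elements of $\mathcal{D}$ ($\mathcal{D}^0$ being the span of the identity), products of matrix spaces are spans of products of elements, and for a matrix space $\mathcal{E}$, $\mathcal{E}(U)=\langle E(u):E\in\mathcal{E},u\in U\rangle$. -}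

module Defs where

open import Level using (Level; _⊔_) renaming (suc to lsuc)
open import Data.Nat using (ℕ; zero; suc; _∸_; _≤_; _<_)
open import Data.Fin using (Fin; toℕ; fromℕ; inject₁)
import Data.Fin as Fin
open import Data.Product using (Σ; ∃; _×_; _,_)
open import Data.Sum using (_⊎_)
open import Relation.Nullary using (¬_; yes; no)
open import Relation.Binary.PropositionalEquality using (_≡_)
open import Relation.Unary using (Pred)
open import Algebra.Bundles using (CommutativeRing)

record Field (c ℓ : Level) : Set (lsuc (c ⊔ ℓ)) where
  field
    commutativeRing : CommutativeRing c ℓ
  open CommutativeRing commutativeRing public
  field
    0≉1     : ¬ (0# ≈ 1#)
    inverse : ∀ x → ¬ (x ≈ 0#) → Σ Carrier (λ y → (x * y) ≈ 1#)

module _ {s a e : Level} {S : Set s} {A : Set a}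
         (_≈_ : A → A → Set e) (_+_ : A → A → A) (0v : A) (_·_ : S → A → A) where

  data Span {q : Level} (r : Level) (P : Pred A q) : A → Set (s ⊔ a ⊔ e ⊔ q ⊔ r) where
    gen  : ∀ {x} → P x → Span r P x
    zer  : Span r P 0v
    add  : ∀ {x y} → Span r P x → Span r P y → Span r P (x + y)
    scal : ∀ λ' {x} → Span r P x → Span r P (λ' · x)
    resp : ∀ {x y} → x ≈ y → Span r P x → Span r P y

  record IsSubspace {p : Level} (P : Pred A p) : Set (s ⊔ a ⊔ e ⊔ p) where
    field
      has-zero  : P 0v
      add-closed : ∀ {x y} → P x → P y → P (x + y)
      scal-closed : ∀ λ' {x} → P x → P (λ' · x)
      respects  : ∀ {x y} → x ≈ y → P x → P y

module Matrices {c ℓ : Level} (F : Field c ℓ) (n : ℕ) (p : Level) where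
  open Field F

  infix  4 _≈ᵥ_ _≈ₘ_ _⊆ᵥ_ _⟨_⟩⊆_
  infixl 6 _+ᵥ_ _+ₘ_
  infixl 7 _*ₘ_ _·ᵥ_ _·ₘ_ _⊙_
  infixr 8 _^ₘ_ _^ˢ_
  infix  9 _$ᵥ_
  infixl 5 _⟦_⟧

  Vect : Set c
  Vect = Fin n → Carrier

  Mat : Set c
  Mat = Fin n → Fin n → Carrier

  sumF : (m : ℕ) → (Fin m → Carrier) → Carrier
  sumF zero    f = 0#
  sumF (suc m) f = f Fin.zero + sumF m (λ i → f (Fin.suc i))

  _≈ᵥ_ : Vect → Vect → Set ℓ
  u ≈ᵥ v = ∀ i → u i ≈ v i

  _≈ₘ_ : Mat → Mat → Set ℓ
  A ≈ₘ B = ∀ i j → A i j ≈ B i j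

  _+ᵥ_ : Vect → Vect → Vect
  (u +ᵥ v) i = u i + v i

  0ᵥ : Vect
  0ᵥ i = 0#

  _·ᵥ_ : Carrier → Vect → Vect
  (a ·ᵥ v) i = a * v i

  _+ₘ_ : Mat → Mat → Mat
  (A +ₘ B) i j = A i j + B i j

  0ₘ : Mat
  0ₘ i j = 0#

  _·ₘ_ : Carrier → Mat → Mat
  (a ·ₘ A) i j = a * A i j

  Iₘ : Mat
  Iₘ i j with i Fin.≟ j
  ... | yes _ = 1#
  ... | no  _ = 0#

  _*ₘ_ : Mat → Mat → Mat
  (A *ₘ B) i j = sumF n (λ k → A i k * B k j)

  _$ᵥ_ : Mat → Vect → Vect
  (A $ᵥ v) i = sumF n (λ k → A i k * v k)

  _^ₘ_ : Mat → ℕ → Mat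
  X ^ₘ zero  = Iₘ
  X ^ₘ suc k = X *ₘ (X ^ₘ k)

  -- X_1 + ... + X_m  (family indexed by Fin m, index i standing for i+1)
  sumₘ : (m : ℕ) → (Fin m → Mat) → Mat
  sumₘ zero    Xs = 0ₘ
  sumₘ (suc m) Xs = Xs Fin.zero +ₘ sumₘ m (λ i → Xs (Fin.suc i))

  prodDesc : (m : ℕ) → (Fin m → Mat) → Mat
  prodDesc zero    Xs = Iₘ
  prodDesc (suc m) Xs = Xs (fromℕ m) *ₘ prodDesc m (λ i → Xs (inject₁ i))

  IsVecSubspace : ∀ {p} → Pred Vect p → Set (c ⊔ ℓ ⊔ p)
  IsVecSubspace = IsSubspace _≈ᵥ_ _+ᵥ_ 0ᵥ _·ᵥ_

  IsMatSpace : ∀ {p} → Pred Mat p → Set (c ⊔ ℓ ⊔ p)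
  IsMatSpace = IsSubspace _≈ₘ_ _+ₘ_ 0ₘ _·ₘ_

  VSpan : ∀ (p : Level) {q} → Pred Vect q → Pred Vect (c ⊔ ℓ ⊔ p ⊔ q)
  VSpan p P = Span _≈ᵥ_ _+ᵥ_ 0ᵥ _·ᵥ_ p P

  MSpan : ∀ (p : Level) {q} → Pred Mat q → Pred Mat (c ⊔ ℓ ⊔ p ⊔ q)
  MSpan p P = Span _≈ₘ_ _+ₘ_ 0ₘ _·ₘ_ p P

  _⊙_ : Pred Mat (c ⊔ ℓ ⊔ p) → Pred Mat (c ⊔ ℓ ⊔ p) → Pred Mat (c ⊔ ℓ ⊔ p)
  (E ⊙ E') = MSpan p (λ M → Σ Mat (λ A → Σ Mat (λ B → E A × E' B × (M ≈ₘ (A *ₘ B)))))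

  ⟨_⟩ₘ : Mat → Pred Mat (c ⊔ ℓ ⊔ p)
  ⟨ X ⟩ₘ = MSpan p (λ M → M ≈ₘ X)

  _^ˢ_ : Pred Mat p → ℕ → Pred Mat (c ⊔ ℓ ⊔ p)
  D ^ˢ zero  = MSpan p (λ M → M ≈ₘ Iₘ)
  D ^ˢ suc k = MSpan p (λ M → Σ Mat (λ A → Σ Mat (λ B → D A × (D ^ˢ k) B × (M ≈ₘ (A *ₘ B)))))

  _⟦_⟧ : Pred Mat (c ⊔ ℓ ⊔ p) → Pred Vect p → Pred Vect (c ⊔ ℓ ⊔ p)
  E ⟦ U ⟧ = VSpan p (λ v → Σ Mat (λ A → Σ Vect (λ u → E A × U u × (v ≈ᵥ (A $ᵥ u)))))

  _⟨_⟩⊆_ : ∀ {p q} → Mat → Pred Vect p → Pred Vect q → Set (c ⊔ p ⊔ q)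
  X ⟨ U ⟩⊆ U' = ∀ u → U u → U' (X $ᵥ u)

  _⊆ᵥ_ : ∀ {p q} → Pred Vect p → Pred Vect q → Set (c ⊔ p ⊔ q)
  P ⊆ᵥ Q = ∀ v → P v → Q v

  IsEll : Pred Mat p → Pred Vect p → Pred Vect p → ℕ → Set (c ⊔ ℓ ⊔ p)
  IsEll D U U' L =
      ((1 ≤ L) × ¬ ((D ^ˢ L) ⟦ U ⟧ ⊆ᵥ U')
               × (∀ j → 1 ≤ j → j < L → (D ^ˢ j) ⟦ U ⟧ ⊆ᵥ U'))
    ⊎ ((L ≡ n)
               × (∀ j → 1 ≤ j → (D ^ˢ j) ⟦ U ⟧ ⊆ᵥ U'))

  -- H_i (i : Fin L stands for i+1):
  -- X ∈ D and D^(L-j) X D^(j-1) (U) ⊆ U' for all j ∈ {1..L} \ {i}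
  H : Pred Mat p → Pred Vect p → Pred Vect p → (L : ℕ) → Fin L → Pred Mat (c ⊔ ℓ ⊔ p)
  H D U U' L i X =
    D X × (∀ (j : Fin L) → ¬ (j ≡ i) →
             (((D ^ˢ (L ∸ suc (toℕ j))) ⊙ ⟨ X ⟩ₘ) ⊙ (D ^ˢ toℕ j)) ⟦ U ⟧ ⊆ᵥ U')

-- Expand (X₁ + ⋯ + X_ℓ)^ℓ into words X_{a_ℓ} ⋯ X_{a_1}.  Every word other than X_ℓ ⋯ X_1 has a
-- first position j with a_j ≠ j and so lies in D^{ℓ-j} X_{a_j} D^{j-1}; as X_{a_j} ∈ H_{a_j} and
-- j ≠ a_j, it maps U into U'.  Hence X^ℓ u − X_ℓ ⋯ X_1 u ∈ U' for u ∈ U.  The expansion is done by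
-- induction on k: X^k u = X_k ⋯ X_1 u + r_k, with r_k spanned by such deviating words of length k.
module Submission where

open import Defs
open import Level using (Level; _⊔_)
open import Data.Nat using (ℕ)
open import Data.Fin using (Fin)
open import Data.Product using (_×_)
open import Function.Bundles using (_⇔_)
open import Relation.Unary using (Pred)

import Data.Nat as ℕ
import Data.Nat.Properties as ℕ
open import Data.Fin as Fin using (toℕ; fromℕ; fromℕ<; inject₁; punchIn)
import Data.Fin.Properties as Fin
open import Data.Product using (Σ; _,_; proj₁; proj₂)
open import Data.Empty using (⊥-elim)
open import Relation.Nullary using (yes; no)
open import Relation.Binary.PropositionalEquality as ≡ using (_≡_; _≢_)
open import Function.Bundles using (mk⇔; Equivalence)

module LinearAlgebra {c ℓ p : Level} (F : Field c ℓ) (n : ℕ) where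
  open Field F
  open Matrices F n p
  open import Algebra.Properties.Semiring.Sum semiring
  open import Algebra.Properties.Ring ring using (-1*x≈-x)
  open import Algebra.Properties.Group +-group using (//-rightDividesʳ)
  open import Algebra.Properties.CommutativeSemigroup +-commutativeSemigroup using (x∙yz≈y∙xz)
  open import Relation.Binary.Reasoning.Setoid setoid

  sumF≡sum : ∀ m (f : Fin m → Carrier) → sumF m f ≡ sum f
  sumF≡sum ℕ.zero    f = ≡.refl
  sumF≡sum (ℕ.suc m) f = ≡.cong (f Fin.zero +_) (sumF≡sum m (λ i → f (Fin.suc i)))

  sumF-cong : ∀ m {f g : Fin m → Carrier} → (∀ i → f i ≈ g i) → sumF m f ≈ sumF m g
  sumF-cong m {f} {g} f≈g rewrite sumF≡sum m f | sumF≡sum m g = sum-cong-≋ f≈g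

  sumF-zero : ∀ m {f : Fin m → Carrier} → (∀ i → f i ≈ 0#) → sumF m f ≈ 0#
  sumF-zero m f≈0 =
    trans (sumF-cong m f≈0) (≡.subst (_≈ 0#) (≡.sym (sumF≡sum m _)) (sum-replicate-zero m))

  sumF-distrib-+ : ∀ m (f g : Fin m → Carrier) → sumF m (λ i → f i + g i) ≈ sumF m f + sumF m g
  sumF-distrib-+ m f g
    rewrite sumF≡sum m (λ i → f i + g i) | sumF≡sum m f | sumF≡sum m g = ∑-distrib-+ f g

  *-distribˡ-sumF : ∀ m x (f : Fin m → Carrier) → x * sumF m f ≈ sumF m (λ i → x * f i)
  *-distribˡ-sumF m x f rewrite sumF≡sum m f | sumF≡sum m (λ i → x * f i) = *-distribˡ-sum x f

  *-distribʳ-sumF : ∀ m x (f : Fin m → Carrier) → sumF m f * x ≈ sumF m (λ i → f i * x)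
  *-distribʳ-sumF m x f rewrite sumF≡sum m f | sumF≡sum m (λ i → f i * x) = *-distribʳ-sum x f

  sumF-comm : ∀ m k (f : Fin m → Fin k → Carrier) →
              sumF m (λ i → sumF k (f i)) ≈ sumF k (λ j → sumF m (λ i → f i j))
  sumF-comm m k f = begin
    sumF m (λ i → sumF k (f i))        ≈⟨ sumF-cong m (λ i → reflexive (sumF≡sum k _)) ⟩
    sumF m (λ i → sum (f i))           ≡⟨ sumF≡sum m _ ⟩
    sum (λ i → sum (f i))              ≈⟨ ∑-comm f ⟩
    sum (λ j → sum (λ i → f i j))      ≡⟨ sumF≡sum k _ ⟨
    sumF k (λ j → sum (λ i → f i j))   ≈⟨ sumF-cong k (λ j → reflexive (sumF≡sum m _)) ⟨
    sumF k (λ j → sumF m (λ i → f i j)) ∎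

  sumF-δ : ∀ m (f : Fin m → Carrier) i → (∀ k → k ≢ i → f k ≈ 0#) → sumF m f ≈ f i
  sumF-δ (ℕ.suc m) f i f≈0 = begin
    sumF (ℕ.suc m) f                   ≡⟨ sumF≡sum (ℕ.suc m) f ⟩
    sum f                              ≈⟨ sum-remove f ⟩
    f i + sum (λ k → f (punchIn i k))  ≡⟨ ≡.cong (f i +_) (sumF≡sum m _) ⟨
    f i + sumF m (λ k → f (punchIn i k))
      ≈⟨ +-congˡ (sumF-zero m (λ k → f≈0 (punchIn i k) (Fin.punchInᵢ≢i i k))) ⟩
    f i + 0#                           ≈⟨ +-identityʳ (f i) ⟩
    f i                                ∎

  ≈ₘ-refl : ∀ {A} → A ≈ₘ A
  ≈ₘ-refl i j = refl

  ≡⇒≈ₘ : ∀ {A B} → A ≡ B → A ≈ₘ B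
  ≡⇒≈ₘ ≡.refl = ≈ₘ-refl

  $ᵥ-congˡ : ∀ {A B} v → A ≈ₘ B → (A $ᵥ v) ≈ᵥ (B $ᵥ v)
  $ᵥ-congˡ v A≈B i = sumF-cong n (λ k → *-congʳ (A≈B i k))

  $ᵥ-congʳ : ∀ A {u v} → u ≈ᵥ v → (A $ᵥ u) ≈ᵥ (A $ᵥ v)
  $ᵥ-congʳ A u≈v i = sumF-cong n (λ k → *-congˡ (u≈v k))

  *ₘ-cong : ∀ {A A' B B'} → A ≈ₘ A' → B ≈ₘ B' → (A *ₘ B) ≈ₘ (A' *ₘ B')
  *ₘ-cong A≈A' B≈B' i j = sumF-cong n (λ k → *-cong (A≈A' i k) (B≈B' k j))

  $ᵥ-distrib-+ᵥ : ∀ A u v → (A $ᵥ (u +ᵥ v)) ≈ᵥ ((A $ᵥ u) +ᵥ (A $ᵥ v))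
  $ᵥ-distrib-+ᵥ A u v i = trans (sumF-cong n (λ k → distribˡ _ _ _)) (sumF-distrib-+ n _ _)

  $ᵥ-·ᵥ : ∀ A x v → (A $ᵥ (x ·ᵥ v)) ≈ᵥ (x ·ᵥ (A $ᵥ v))
  $ᵥ-·ᵥ A x v i =
    trans (sumF-cong n (λ k → x*-commute (A i k) (v k))) (sym (*-distribˡ-sumF n x _))
    where
    x*-commute : ∀ a b → a * (x * b) ≈ x * (a * b)
    x*-commute a b = trans (sym (*-assoc a x b)) (trans (*-congʳ (*-comm a x)) (*-assoc x a b))

  $ᵥ-0ᵥ : ∀ A → (A $ᵥ 0ᵥ) ≈ᵥ 0ᵥ
  $ᵥ-0ᵥ A i = sumF-zero n (λ k → zeroʳ (A i k))

  +ₘ-$ᵥ : ∀ A B v → ((A +ₘ B) $ᵥ v) ≈ᵥ ((A $ᵥ v) +ᵥ (B $ᵥ v))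
  +ₘ-$ᵥ A B v i = trans (sumF-cong n (λ k → distribʳ _ _ _)) (sumF-distrib-+ n _ _)

  0ₘ-$ᵥ : ∀ v → (0ₘ $ᵥ v) ≈ᵥ 0ᵥ
  0ₘ-$ᵥ v i = sumF-zero n (λ k → zeroˡ (v k))

  *ₘ-$ᵥ : ∀ A B v → ((A *ₘ B) $ᵥ v) ≈ᵥ (A $ᵥ (B $ᵥ v))
  *ₘ-$ᵥ A B v i = begin
    sumF n (λ k → sumF n (λ l → A i l * B l k) * v k)
      ≈⟨ sumF-cong n (λ k → *-distribʳ-sumF n (v k) (λ l → A i l * B l k)) ⟩
    sumF n (λ k → sumF n (λ l → A i l * B l k * v k))
      ≈⟨ sumF-comm n n _ ⟩
    sumF n (λ l → sumF n (λ k → A i l * B l k * v k))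
      ≈⟨ sumF-cong n (λ l → sumF-cong n (λ k → *-assoc (A i l) (B l k) (v k))) ⟩
    sumF n (λ l → sumF n (λ k → A i l * (B l k * v k)))
      ≈⟨ sumF-cong n (λ l → *-distribˡ-sumF n (A i l) (λ k → B l k * v k)) ⟨
    sumF n (λ l → A i l * sumF n (λ k → B l k * v k)) ∎

  Iₘ-$ᵥ : ∀ v → (Iₘ $ᵥ v) ≈ᵥ v
  Iₘ-$ᵥ v i = trans (sumF-δ n _ i off-diagonal) (trans (*-congʳ diagonal) (*-identityˡ (v i)))
    where
    diagonal : Iₘ i i ≈ 1#
    diagonal with i Fin.≟ i
    ... | yes _  = refl
    ... | no i≢i = ⊥-elim (i≢i ≡.refl)
    off-diagonal : ∀ k → k ≢ i → Iₘ i k * v k ≈ 0#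
    off-diagonal k k≢i with i Fin.≟ k
    ... | yes i≡k = ⊥-elim (k≢i (≡.sym i≡k))
    ... | no _    = zeroˡ (v k)

  span-isSubspace : ∀ {q} {G : Pred Vect q} → IsVecSubspace (VSpan p G)
  span-isSubspace = record
    { has-zero = zer ; add-closed = add ; scal-closed = scal ; respects = resp }

  span-minimal : ∀ {q r} {G : Pred Vect q} {Q : Pred Vect r} →
                 IsVecSubspace Q → (∀ v → G v → Q v) → ∀ v → VSpan p G v → Q v
  span-minimal Q G⊆Q v (gen g)     = G⊆Q v g
  span-minimal Q G⊆Q _ zer         = IsSubspace.has-zero Q
  span-minimal Q G⊆Q _ (add s t)   =
    IsSubspace.add-closed Q (span-minimal Q G⊆Q _ s) (span-minimal Q G⊆Q _ t)
  span-minimal Q G⊆Q _ (scal x s)  = IsSubspace.scal-closed Q x (span-minimal Q G⊆Q _ s)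
  span-minimal Q G⊆Q _ (resp e s)  = IsSubspace.respects Q e (span-minimal Q G⊆Q _ s)

  preimage-isSubspace : ∀ {r} {Q : Pred Vect r} (A : Mat) →
                        IsVecSubspace Q → IsVecSubspace (λ v → Q (A $ᵥ v))
  preimage-isSubspace A Q = record
    { has-zero    = respects (λ i → sym ($ᵥ-0ᵥ A i)) has-zero
    ; add-closed  = λ Qu Qv → respects (λ i → sym ($ᵥ-distrib-+ᵥ A _ _ i)) (add-closed Qu Qv)
    ; scal-closed = λ x Qv → respects (λ i → sym ($ᵥ-·ᵥ A x _ i)) (scal-closed x Qv)
    ; respects    = λ u≈v → respects ($ᵥ-congʳ A u≈v)
    }
    where open IsSubspace Q

  sumₘ-closed : ∀ {r} {D : Pred Mat r} → IsMatSpace D →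
                ∀ m (Xs : Fin m → Mat) → (∀ a → D (Xs a)) → D (sumₘ m Xs)
  sumₘ-closed D ℕ.zero    Xs Xs∈D = IsSubspace.has-zero D
  sumₘ-closed D (ℕ.suc m) Xs Xs∈D =
    IsSubspace.add-closed D (Xs∈D Fin.zero) (sumₘ-closed D m _ (λ a → Xs∈D (Fin.suc a)))

  sumₘ-$ᵥ-closed : ∀ {r} {Q : Pred Vect r} → IsVecSubspace Q →
                   ∀ m (Xs : Fin m → Mat) w → (∀ a → Q (Xs a $ᵥ w)) → Q (sumₘ m Xs $ᵥ w)
  sumₘ-$ᵥ-closed Q ℕ.zero    Xs w QXs = respects (λ i → sym (0ₘ-$ᵥ w i)) has-zero
    where open IsSubspace Q
  sumₘ-$ᵥ-closed Q (ℕ.suc m) Xs w QXs =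
    respects (λ i → sym (+ₘ-$ᵥ (Xs Fin.zero) (sumₘ m (λ a → Xs (Fin.suc a))) w i))
      (add-closed (QXs Fin.zero) (sumₘ-$ᵥ-closed Q m _ w (λ a → QXs (Fin.suc a))))
    where open IsSubspace Q

  sumₘ-$ᵥ-split : ∀ {q} {Q : Pred Vect q} → IsVecSubspace Q →
                  ∀ m (Xs : Fin m → Mat) w i → (∀ a → a ≢ i → Q (Xs a $ᵥ w)) →
                  Σ Vect λ r → Q r × ((sumₘ m Xs $ᵥ w) ≈ᵥ ((Xs i $ᵥ w) +ᵥ r))
  sumₘ-$ᵥ-split Q (ℕ.suc m) Xs w Fin.zero QXs =
    sumₘ m (λ a → Xs (Fin.suc a)) $ᵥ w ,
    sumₘ-$ᵥ-closed Q m _ w (λ a → QXs (Fin.suc a) λ ()) ,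
    +ₘ-$ᵥ (Xs Fin.zero) (sumₘ m (λ a → Xs (Fin.suc a))) w
  sumₘ-$ᵥ-split Q (ℕ.suc m) Xs w (Fin.suc i) QXs
    with sumₘ-$ᵥ-split Q m (λ a → Xs (Fin.suc a)) w i
                       (λ a a≢i → QXs (Fin.suc a) (λ e → a≢i (Fin.suc-injective e)))
  ... | r , Qr , split =
    (Xs Fin.zero $ᵥ w) +ᵥ r ,
    IsSubspace.add-closed Q (QXs Fin.zero λ ()) Qr ,
    λ t → trans (+ₘ-$ᵥ (Xs Fin.zero) (sumₘ m (λ a → Xs (Fin.suc a))) w t)
                (trans (+-congˡ (split t)) (x∙yz≈y∙xz _ _ _))

  translate-⇔ : ∀ {r} {Q : Pred Vect r} → IsVecSubspace Q →
                ∀ {x y z} → x ≈ᵥ (y +ᵥ z) → Q z → Q x ⇔ Q y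
  translate-⇔ Q {x} {y} {z} x≈y+z Qz = mk⇔
    (λ Qx → respects x-z≈y (add-closed Qx (scal-closed (- 1#) Qz)))
    (λ Qy → respects (λ i → sym (x≈y+z i)) (add-closed Qy Qz))
    where
    open IsSubspace Q
    x-z≈y : (x +ᵥ (- 1# ·ᵥ z)) ≈ᵥ y
    x-z≈y i = begin
      x i + - 1# * z i  ≈⟨ +-cong (x≈y+z i) (-1*x≈-x (z i)) ⟩
      y i + z i - z i   ≈⟨ //-rightDividesʳ (z i) (y i) ⟩
      y i               ∎

module PowerOfSum {c ℓ p : Level} (F : Field c ℓ) (n : ℕ) where
  open Field F
  open Matrices F n p
  open LinearAlgebra {p = p} F n
  open import Relation.Binary.Reasoning.Setoid setoid

  module _ (D : Pred Mat p) {L : ℕ} (Xs : Fin L → Mat) where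

    -- w = A Xₐ B u with B ∈ D^j, A ∈ D^m and a ≠ j: a word of length j + 1 + m whose letter at
    -- position j is not X_j (positions and letters are 0-based, unlike the paper's X₁ … X_ℓ).
    record DeviatingWord (u : Vect) (k : ℕ) (w : Vect) : Set (c ⊔ ℓ ⊔ p) where
      field
        position letter : Fin L
        position≢letter : position ≢ letter
        {tail}          : ℕ
        length          : ℕ.suc (toℕ position) ℕ.+ tail ≡ k
        {A B}           : Mat
        A∈D^            : (D ^ˢ tail) A
        B∈D^            : (D ^ˢ toℕ position) B
        w≈              : w ≈ᵥ (A $ᵥ (Xs letter $ᵥ (B $ᵥ u)))

    Deviations : Vect → ℕ → Pred Vect (c ⊔ ℓ ⊔ p)
    Deviations u k = VSpan p (DeviatingWord u k)

    deviations-$ᵥ : ∀ {u k Y} → D Y →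
                    ∀ w → Deviations u k w → Deviations u (ℕ.suc k) (Y $ᵥ w)
    deviations-$ᵥ {u} {k} {Y} Y∈D = span-minimal (preimage-isSubspace Y span-isSubspace) extend
      where
      extend : ∀ w → DeviatingWord u k w → Deviations u (ℕ.suc k) (Y $ᵥ w)
      extend w d = gen record
        { position        = position
        ; letter          = letter
        ; position≢letter = position≢letter
        ; length          = ≡.trans (ℕ.+-suc (ℕ.suc (toℕ position)) tail) (≡.cong ℕ.suc length)
        ; A∈D^            = gen (Y , A , Y∈D , A∈D^ , ≈ₘ-refl)
        ; B∈D^            = B∈D^
        ; w≈              = λ i → trans ($ᵥ-congʳ Y w≈ i) (sym (*ₘ-$ᵥ Y A _ i))
        }
        where open DeviatingWord d

    deviations-⊆ : ∀ {U U' : Pred Vect p} → IsVecSubspace U' → (∀ a → H D U U' L a (Xs a)) →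
                   ∀ {u} → U u → ∀ w → Deviations u L w → U' w
    deviations-⊆ {U' = U'} U'-space Xs∈H {u} u∈U = span-minimal U'-space word∈U'
      where
      word∈U' : ∀ w → DeviatingWord u L w → U' w
      word∈U' w d = proj₂ (Xs∈H letter) position position≢letter w
        (gen ((A *ₘ Xs letter) *ₘ B , u ,
              gen (A *ₘ Xs letter , B , gen (A , Xs letter , A∈D^′ , gen ≈ₘ-refl , ≈ₘ-refl) ,
                   B∈D^ , ≈ₘ-refl) ,
              u∈U , w≈′))
        where
        open DeviatingWord d
        tail≡ : L ℕ.∸ ℕ.suc (toℕ position) ≡ tail
        tail≡ = ≡.subst (λ k → k ℕ.∸ ℕ.suc (toℕ position) ≡ tail) length
                        (ℕ.m+n∸m≡n (ℕ.suc (toℕ position)) tail)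
        A∈D^′ : (D ^ˢ (L ℕ.∸ ℕ.suc (toℕ position))) A
        A∈D^′ = ≡.subst (λ m → (D ^ˢ m) A) (≡.sym tail≡) A∈D^
        w≈′ : w ≈ᵥ (((A *ₘ Xs letter) *ₘ B) $ᵥ u)
        w≈′ i = trans (w≈ i)
                      (sym (trans (*ₘ-$ᵥ (A *ₘ Xs letter) B u i) (*ₘ-$ᵥ A (Xs letter) (B $ᵥ u) i)))

    module _ (D-space : IsMatSpace D) (Xs∈D : ∀ a → D (Xs a)) where

      -- Xs extended by zero beyond L, so that prefix products can be indexed by ℕ.
      X : ℕ → Mat
      X k with k ℕ.<? L
      ... | yes k<L = Xs (fromℕ< k<L)
      ... | no _    = 0ₘ

      X-fromℕ< : ∀ {k} (k<L : k ℕ.< L) → X k ≡ Xs (fromℕ< k<L)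
      X-fromℕ< {k} k<L with k ℕ.<? L
      ... | yes _  = ≡.refl
      ... | no k≮L = ⊥-elim (k≮L k<L)

      X∈D : ∀ k → D (X k)
      X∈D k with k ℕ.<? L
      ... | yes _ = Xs∈D _
      ... | no _  = IsSubspace.has-zero D-space

      prefix : ℕ → Mat
      prefix ℕ.zero    = Iₘ
      prefix (ℕ.suc k) = X k *ₘ prefix k

      prefix∈D^ : ∀ k → (D ^ˢ k) (prefix k)
      prefix∈D^ ℕ.zero    = gen ≈ₘ-refl
      prefix∈D^ (ℕ.suc k) = gen (X k , prefix k , X∈D k , prefix∈D^ k , ≈ₘ-refl)

      prodDesc≈prefix : ∀ m (Ys : Fin m → Mat) → (∀ i → Ys i ≡ X (toℕ i)) →
                        prodDesc m Ys ≈ₘ prefix m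
      prodDesc≈prefix ℕ.zero    Ys Ys≡X = ≈ₘ-refl
      prodDesc≈prefix (ℕ.suc m) Ys Ys≡X = *ₘ-cong
        (≡⇒≈ₘ (≡.trans (Ys≡X (fromℕ m)) (≡.cong X (Fin.toℕ-fromℕ m))))
        (prodDesc≈prefix m _ (λ i → ≡.trans (Ys≡X (inject₁ i)) (≡.cong X (Fin.toℕ-inject₁ i))))

      S : Mat
      S = sumₘ L Xs

      sum-$ᵥ-prefix : ∀ u k (k<L : k ℕ.< L) → Σ Vect λ r → Deviations u (ℕ.suc k) r ×
                      ((S $ᵥ (prefix k $ᵥ u)) ≈ᵥ ((prefix (ℕ.suc k) $ᵥ u) +ᵥ r))
      sum-$ᵥ-prefix u k k<L
        with sumₘ-$ᵥ-split span-isSubspace L Xs (prefix k $ᵥ u) (fromℕ< k<L) deviating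
        where
        deviating : ∀ a → a ≢ fromℕ< k<L → Deviations u (ℕ.suc k) (Xs a $ᵥ (prefix k $ᵥ u))
        deviating a a≢k = gen record
          { position        = fromℕ< k<L
          ; letter          = a
          ; position≢letter = λ k≡a → a≢k (≡.sym k≡a)
          ; length          = ≡.trans (ℕ.+-identityʳ _) (≡.cong ℕ.suc (Fin.toℕ-fromℕ< k<L))
          ; A∈D^            = gen ≈ₘ-refl
          ; B∈D^            = ≡.subst (λ j → (D ^ˢ j) (prefix k)) (≡.sym (Fin.toℕ-fromℕ< k<L))
                                      (prefix∈D^ k)
          ; w≈              = λ i → sym (Iₘ-$ᵥ _ i)
          }
      ... | r , r∈ , split = r , r∈ , λ i → trans (split i) (+-congʳ (sym (next i)))
        where
        next : (prefix (ℕ.suc k) $ᵥ u) ≈ᵥ (Xs (fromℕ< k<L) $ᵥ (prefix k $ᵥ u))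
        next i = trans (*ₘ-$ᵥ (X k) (prefix k) u i) ($ᵥ-congˡ _ (≡⇒≈ₘ (X-fromℕ< k<L)) i)

      power-expansion : ∀ u k → k ℕ.≤ L → Σ Vect λ r → Deviations u k r ×
                        (((S ^ₘ k) $ᵥ u) ≈ᵥ ((prefix k $ᵥ u) +ᵥ r))
      power-expansion u ℕ.zero _ = 0ᵥ , zer , λ i → sym (+-identityʳ _)
      power-expansion u (ℕ.suc k) k<L
        with power-expansion u k (ℕ.<⇒≤ k<L) | sum-$ᵥ-prefix u k k<L
      ... | r , r∈ , S^k≈ | r' , r'∈ , S-prefix≈ =
        r' +ᵥ (S $ᵥ r) ,
        add r'∈ (deviations-$ᵥ (sumₘ-closed D-space L Xs Xs∈D) r r∈) ,
        λ i → begin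
          ((S *ₘ (S ^ₘ k)) $ᵥ u) i                          ≈⟨ *ₘ-$ᵥ S (S ^ₘ k) u i ⟩
          (S $ᵥ ((S ^ₘ k) $ᵥ u)) i                          ≈⟨ $ᵥ-congʳ S S^k≈ i ⟩
          (S $ᵥ ((prefix k $ᵥ u) +ᵥ r)) i                   ≈⟨ $ᵥ-distrib-+ᵥ S _ r i ⟩
          (S $ᵥ (prefix k $ᵥ u)) i + (S $ᵥ r) i             ≈⟨ +-congʳ (S-prefix≈ i) ⟩
          (prefix (ℕ.suc k) $ᵥ u) i + r' i + (S $ᵥ r) i     ≈⟨ +-assoc _ _ _ ⟩
          (prefix (ℕ.suc k) $ᵥ u) i + (r' i + (S $ᵥ r) i)   ∎

      power-≈-prodDesc+deviation : ∀ u → Σ Vect λ r → Deviations u L r ×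
                                   (((S ^ₘ L) $ᵥ u) ≈ᵥ ((prodDesc L Xs $ᵥ u) +ᵥ r))
      power-≈-prodDesc+deviation u with power-expansion u L ℕ.≤-refl
      ... | r , r∈ , S^L≈ = r , r∈ , λ i → trans (S^L≈ i) (+-congʳ (sym (prodDesc-$ᵥ i)))
        where
        Xs≡X : ∀ i → Xs i ≡ X (toℕ i)
        Xs≡X i = ≡.sym (≡.trans (X-fromℕ< (Fin.toℕ<n i))
                                (≡.cong Xs (Fin.fromℕ<-toℕ i (Fin.toℕ<n i))))
        prodDesc-$ᵥ : (prodDesc L Xs $ᵥ u) ≈ᵥ (prefix L $ᵥ u)
        prodDesc-$ᵥ = $ᵥ-congˡ u (prodDesc≈prefix L Xs Xs≡X)

lemma5 : ∀ {c ℓ p : Level} (F : Field c ℓ) (n : ℕ) →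
    let open Matrices F n p in
    (D : Pred Mat p) (U U' : Pred Vect p) →
    IsMatSpace D → IsVecSubspace U → IsVecSubspace U' →
    (L : ℕ) → IsEll D U U' L →
    (Xs : Fin L → Mat) → (∀ i → H D U U' L i (Xs i)) →
    ((sumₘ L Xs ^ₘ L) ⟨ U ⟩⊆ U') ⇔ (prodDesc L Xs ⟨ U ⟩⊆ U')
lemma5 {p = p} F n D U U' D-space _ U'-space L _ Xs Xs∈H =
  mk⇔ (λ S^L⊆U' u u∈U → Equivalence.to (pointwise u∈U) (S^L⊆U' u u∈U))
      (λ P⊆U' u u∈U → Equivalence.from (pointwise u∈U) (P⊆U' u u∈U))
  where
  open Matrices F n p
  open LinearAlgebra {p = p} F n
  open PowerOfSum {p = p} F n
  pointwise : ∀ {u} → U u → U' ((sumₘ L Xs ^ₘ L) $ᵥ u) ⇔ U' (prodDesc L Xs $ᵥ u)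
  pointwise {u} u∈U with power-≈-prodDesc+deviation D Xs D-space (λ a → proj₁ (Xs∈H a)) u
  ... | r , r∈ , S^L≈ = translate-⇔ U'-space S^L≈ (deviations-⊆ D Xs U'-space Xs∈H u∈U r r∈)
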